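{- Let $E$ be a finite set, $\Gamma_x$ ($x\in E$) finite groups, $\mathcal{G}=\prod_{x\in E}\Gamma_x$, $\mathcal{H}\le\mathcal{G}$, $b>1$, and $P=P(\mathcal{H},b)$. If $S$ is a flat of $P$, then there exist $h_1,\dots,h_l\in\mathcal{H}$ with $l\le|E-S|$ such that $S=\bigcap_{i=1}^l I(h_i)$.
   Context: $\mathcal{H}_S$ is the image of $\mathcal{H}$ under the projection $\mathcal{G}\to\prod_{x\in S}\Gamma_x$ ($\mathcal{H}_\emptyset$ trivial); $P(\mathcal{H},b)=(E,r)$ with $r(S)=\log_b|\mathcal{H}_S|$. A flat of $(E,r)$ is a set $S\subseteq E$ with $r(S\cup\{x\})>r(S)$ for all $x\notin S$. For $h\in\mathcal{H}$, $I(h)=\{x\in E:h_x=1_{\Gamma_x}\}$. An empty intersection of subsets of $E$ is $E$. -}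

module Defs where

open import Data.Nat using (ℕ; zero; suc; _<_)
open import Data.Fin using (Fin; zero; suc)
open import Data.Fin.Properties using (_≟_; all?)
open import Data.Fin.Subset using (Subset; _∈_; _∉_; _∪_; ⁅_⁆)
open import Data.Fin.Subset.Properties using (_∈?_)
open import Data.List using (List; []; _∷_; map; concatMap; filter; length; allFin)
open import Data.List.Relation.Unary.Any using (Any; any?)
open import Data.Product using (Σ; _×_; _,_)
open import Relation.Nullary using (Dec; ¬_)
open import Relation.Nullary.Decidable using (_×-dec_; _→-dec_; ¬?)
open import Relation.Binary.PropositionalEquality using (_≡_)
open import Algebra.Structures using (IsGroup)

-- A finite group, presented (up to isomorphism) on the carrier Fin order
-- with propositional equality.
record FinGroup : Set where
  field
    order   : ℕ
    _∙_     : Fin order → Fin order → Fin order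
    ε       : Fin order
    _⁻¹     : Fin order → Fin order
    isGroup : IsGroup _≡_ _∙_ ε _⁻¹

open FinGroup public

𝒢 : {n : ℕ} → (Fin n → FinGroup) → Set
𝒢 {n} Γ = (x : Fin n) → Fin (order (Γ x))

one𝒢 : {n : ℕ} (Γ : Fin n → FinGroup) → 𝒢 Γ
one𝒢 Γ x = ε (Γ x)

mul𝒢 : {n : ℕ} (Γ : Fin n → FinGroup) → 𝒢 Γ → 𝒢 Γ → 𝒢 Γ
mul𝒢 Γ g h x = _∙_ (Γ x) (g x) (h x)

inv𝒢 : {n : ℕ} (Γ : Fin n → FinGroup) → 𝒢 Γ → 𝒢 Γ
inv𝒢 Γ g x = _⁻¹ (Γ x) (g x)

_≈𝒢_ : {n : ℕ} {Γ : Fin n → FinGroup} → 𝒢 Γ → 𝒢 Γ → Set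
g ≈𝒢 h = ∀ x → g x ≡ h x

record Subgroup {n : ℕ} (Γ : Fin n → FinGroup) : Set₁ where
  field
    mem     : 𝒢 Γ → Set
    mem?    : (g : 𝒢 Γ) → Dec (mem g)
    resp    : ∀ {g h} → _≈𝒢_ {Γ = Γ} g h → mem g → mem h
    one-mem : mem (one𝒢 Γ)
    mul-mem : ∀ {g h} → mem g → mem h → mem (mul𝒢 Γ g h)
    inv-mem : ∀ {g} → mem g → mem (inv𝒢 Γ g)

open Subgroup public

cons : {n : ℕ} {m : Fin (suc n) → ℕ} → Fin (m zero) →
       ((x : Fin n) → Fin (m (suc x))) → (x : Fin (suc n)) → Fin (m x)
cons a f zero    = a
cons a f (suc x) = f x

enum : (n : ℕ) (m : Fin n → ℕ) → List ((x : Fin n) → Fin (m x))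
enum zero    m = (λ ()) ∷ []
enum (suc n) m =
  concatMap (λ a → map (cons {m = m} a) (enum n (λ x → m (suc x)))) (allFin (m zero))

all𝒢 : {n : ℕ} (Γ : Fin n → FinGroup) → List (𝒢 Γ)
all𝒢 {n} Γ = enum n (λ x → order (Γ x))

-- The product ∏_{x∈S} Γ x is encoded (bijectively) as the elements g of 𝒢
-- with g x = 1 for all x ∉ S.  Such g lies in ℋ_S (the image of ℋ under the
-- projection 𝒢 → ∏_{x∈S} Γ x) iff some h ∈ ℋ agrees with g on S.
InProj : {n : ℕ} {Γ : Fin n → FinGroup} → Subgroup Γ → Subset n → 𝒢 Γ → Set
InProj {n} {Γ} ℋ S g =
  ((x : Fin n) → x ∉ S → g x ≡ ε (Γ x)) ×
  Any (λ h → mem ℋ h × ((x : Fin n) → x ∈ S → h x ≡ g x)) (all𝒢 Γ)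

InProj? : {n : ℕ} {Γ : Fin n → FinGroup} (ℋ : Subgroup Γ) (S : Subset n) →
          (g : 𝒢 Γ) → Dec (InProj ℋ S g)
InProj? {n} {Γ} ℋ S g =
  all? (λ x → ¬? (x ∈? S) →-dec (g x ≟ ε (Γ x))) ×-dec
  any? (λ h → mem? ℋ h ×-dec all? (λ x → (x ∈? S) →-dec (h x ≟ g x))) (all𝒢 Γ)

card : {n : ℕ} {Γ : Fin n → FinGroup} → Subgroup Γ → Subset n → ℕ
card {Γ = Γ} ℋ S = length (filter (InProj? ℋ S) (all𝒢 Γ))

-- r(S) = log_b |ℋ_S| with b > 1; since log_b is strictly increasing,
-- r(S ∪ {x}) > r(S) iff |ℋ_{S∪{x}}| > |ℋ_S|.
IsFlat : {n : ℕ} {Γ : Fin n → FinGroup} → Subgroup Γ → Subset n → Set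
IsFlat ℋ S = ∀ x → x ∉ S → card ℋ S < card ℋ (S ∪ ⁅ x ⁆)

I : {n : ℕ} {Γ : Fin n → FinGroup} → 𝒢 Γ → Fin n → Set
I {Γ = Γ} h x = h x ≡ ε (Γ x)

{-# OPTIONS --safe #-}
-- For x ∉ S, flatness says that restricting ℋ_{S ∪ {x}} to S is not injective.
-- Restriction comes from a group homomorphism, so its kernel is nontrivial:
-- some h ∈ ℋ is the identity on S but not at x.  Choosing one such h for each
-- of the |E - S| points outside S cuts out exactly S.
module Submission where

open import Defs
open import Level using (0ℓ)
open import Algebra.Bundles using (Group)
open import Algebra.Properties.Group using (x∙y⁻¹≈ε⇒x≈y; x≈y⇒x∙y⁻¹≈ε)
open import Data.Nat using (ℕ; zero; suc; _≤_; z≤n; s≤s)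
open import Data.Nat.Properties using (≤-refl; <⇒≱; module ≤-Reasoning)
open import Data.Fin using (Fin; zero; suc)
open import Data.Fin.Properties using (_≟_; all?)
open import Data.Fin.Subset using (Subset; _∈_; _∉_; _⊆_; ∁; ∣_∣; _∪_; ⁅_⁆; inside; outside)
open import Data.Fin.Subset.Properties
  using (_∈?_; p⊆p∪q; x∈p∪q⁻; x∈⁅y⁆⇒x≡y; x∉p⇒x∈∁p; x∈∁p⇒x∉p)
open import Data.Vec using (_∷_; here; there)
open import Data.List
  using (List; []; _∷_; map; _++_; concatMap; cartesianProductWith; filter; length; allFin)
open import Data.List.Properties using (length-map; length-removeAt′)
open import Data.List.Relation.Unary.All as All using (All; []; _∷_)
open import Data.List.Relation.Unary.All.Properties as All using (all-filter)
open import Data.List.Relation.Unary.Any as Any using (here; there; any?)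
import Data.List.Relation.Unary.Any.Properties as Any
open import Data.List.Relation.Unary.AllPairs using ([]; _∷_)
import Data.List.Membership.Setoid as SetoidMembership
open import Data.List.Membership.Setoid.Properties using (∈-resp-≈; ∈-map⁻; ∈-filter⁺; ∈-filter⁻)
open import Data.List.Membership.Propositional.Properties using (∈-allFin)
import Data.List.Relation.Binary.Subset.Setoid as SetoidSubset
open import Data.List.Relation.Unary.Unique.Setoid using (Unique)
import Data.List.Relation.Unary.Unique.Setoid.Properties as Unique
open import Data.List.Relation.Unary.Unique.Propositional.Properties using (allFin⁺)
open import Data.Product using (Σ; ∃; _×_; _,_; proj₁; proj₂; map₂)
open import Data.Sum using (inj₁; inj₂)
open import Data.Empty using (⊥-elim)
open import Function using (_∘_)
open import Function.Bundles using (_⇔_; mk⇔)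
open import Relation.Binary.Bundles using (Setoid)
open import Relation.Binary.Definitions using (_Respects_)
open import Relation.Binary.PropositionalEquality
  using (_≡_; refl; sym; trans; cong; subst; setoid; module ≡-Reasoning)
open import Relation.Nullary using (Dec; yes; no; ¬_)
open import Relation.Nullary.Decidable using (_×-dec_; _→-dec_; ¬?; map′; decidable-stable)
open import Relation.Unary using (Pred; Decidable)

module _ {c ℓ} (A : Setoid c ℓ) where
  open Setoid A using (_≈_) renaming (refl to ≈-refl; sym to ≈-sym; trans to ≈-trans)
  open SetoidMembership A using (_─_) renaming (_∈_ to _∈ₗ_)
  open SetoidSubset A renaming (_⊆_ to _⊆ₗ_)

  ∈-─⁺ : ∀ {x y ys} (x∈ys : x ∈ₗ ys) → y ∈ₗ ys → ¬ y ≈ x → y ∈ₗ ys ─ x∈ys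
  ∈-─⁺ (here x≈z)   (here y≈z)   y≉x = ⊥-elim (y≉x (≈-trans y≈z (≈-sym x≈z)))
  ∈-─⁺ (here _)     (there y∈ys) _   = y∈ys
  ∈-─⁺ (there _)    (here y≈z)   _   = here y≈z
  ∈-─⁺ (there x∈ys) (there y∈ys) y≉x = there (∈-─⁺ x∈ys y∈ys y≉x)

  Unique-⊆⇒length-≤ : ∀ {xs ys} → Unique A xs → xs ⊆ₗ ys → length xs ≤ length ys
  Unique-⊆⇒length-≤ {[]}     _                   _      = z≤n
  Unique-⊆⇒length-≤ {x ∷ xs} {ys} xxs!@(_ ∷ xs!) xxs⊆ys = begin
    suc (length xs)          ≤⟨ s≤s (Unique-⊆⇒length-≤ xs! xs⊆ys─x) ⟩
    suc (length (ys ─ x∈ys)) ≡⟨ length-removeAt′ ys _ ⟨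
    length ys                ∎
    where
    open ≤-Reasoning
    x∈ys : x ∈ₗ ys
    x∈ys = xxs⊆ys (here ≈-refl)
    xs⊆ys─x : xs ⊆ₗ ys ─ x∈ys
    xs⊆ys─x y∈xs = ∈-─⁺ x∈ys (xxs⊆ys (there y∈xs))
      (λ y≈x → Unique.Unique[x∷xs]⇒x∉xs A xxs! (∈-resp-≈ A y≈x y∈xs))

module _ {a b ℓ₁ ℓ₂} (A : Setoid a ℓ₁) (B : Setoid b ℓ₂) where
  open Setoid A using () renaming (_≈_ to _≈₁_)
  open Setoid B using () renaming (_≈_ to _≈₂_)

  Unique-map⁺-injectiveOn :
    ∀ {p} {P : Pred (Setoid.Carrier A) p} {f : Setoid.Carrier A → Setoid.Carrier B} →
    (∀ {x y} → P x → P y → f x ≈₂ f y → x ≈₁ y) →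
    ∀ {xs} → All P xs → Unique A xs → Unique B (map f xs)
  Unique-map⁺-injectiveOn inj []         []           = []
  Unique-map⁺-injectiveOn inj (px ∷ pxs) (x≉xs ∷ xs!) =
    All.map⁺ (All.zipWith (λ (py , x≉y) fx≈fy → x≉y (inj px py fx≈fy)) (pxs , x≉xs))
    ∷ Unique-map⁺-injectiveOn inj pxs xs!

Π-setoid : (n : ℕ) → (Fin n → ℕ) → Setoid 0ℓ 0ℓ
Π-setoid n m = record
  { Carrier       = (x : Fin n) → Fin (m x)
  ; _≈_           = λ f g → ∀ x → f x ≡ g x
  ; isEquivalence = record
    { refl  = λ _ → refl
    ; sym   = λ f≈g x → sym (f≈g x)
    ; trans = λ f≈g g≈h x → trans (f≈g x) (g≈h x)
    }
  }

concatMap-map≡cartesianProductWith : ∀ {A B C : Set} (f : A → B → C) xs ys →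
  concatMap (λ x → map (f x) ys) xs ≡ cartesianProductWith f xs ys
concatMap-map≡cartesianProductWith f []       ys = refl
concatMap-map≡cartesianProductWith f (x ∷ xs) ys =
  cong (map (f x) ys ++_) (concatMap-map≡cartesianProductWith f xs ys)

module _ (n : ℕ) (m : Fin (suc n) → ℕ) where
  open Setoid (Π-setoid (suc n) m) using (_≈_)

  enum-suc : enum (suc n) m ≡ cartesianProductWith cons (allFin (m zero)) (enum n (m ∘ suc))
  enum-suc = concatMap-map≡cartesianProductWith cons (allFin (m zero)) (enum n (m ∘ suc))

  cons-injective : ∀ {a a' f f'} → cons a f ≈ cons a' f' → a ≡ a' × (∀ x → f x ≡ f' x)
  cons-injective cons≈ = cons≈ zero , cons≈ ∘ suc

enum-unique : ∀ n m → Unique (Π-setoid n m) (enum n m)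
enum-unique zero    m = [] ∷ []
enum-unique (suc n) m rewrite enum-suc n m =
  Unique.cartesianProductWith⁺ (setoid (Fin (m zero))) (Π-setoid n (m ∘ suc)) (Π-setoid (suc n) m)
    cons (cons-injective n m) (allFin⁺ (m zero)) (enum-unique n (m ∘ suc))

enum-complete : ∀ n m g → SetoidMembership._∈_ (Π-setoid n m) g (enum n m)
enum-complete zero    m g = here (λ ())
enum-complete (suc n) m g rewrite enum-suc n m =
  Any.cartesianProductWith⁺ (cons {m = m}) cons-≈
    (∈-allFin (g zero)) (enum-complete n (m ∘ suc) (g ∘ suc))
  where
  cons-≈ : ∀ {a f} → g zero ≡ a → (∀ x → g (suc x) ≡ f x) → ∀ x → g x ≡ cons {m = m} a f x
  cons-≈ g₀≡a _    zero    = g₀≡a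
  cons-≈ _    g₊≈f (suc x) = g₊≈f x

enumerate : ∀ {n} (p : Subset n) → Fin ∣ p ∣ → Fin n
enumerate (inside  ∷ p) zero    = zero
enumerate (inside  ∷ p) (suc i) = suc (enumerate p i)
enumerate (outside ∷ p) i       = suc (enumerate p i)

enumerate-∈ : ∀ {n} (p : Subset n) i → enumerate p i ∈ p
enumerate-∈ (inside  ∷ p) zero    = here
enumerate-∈ (inside  ∷ p) (suc i) = there (enumerate-∈ p i)
enumerate-∈ (outside ∷ p) i       = there (enumerate-∈ p i)

enumerate-surjective : ∀ {n} {p : Subset n} {x} → x ∈ p → ∃ λ i → enumerate p i ≡ x
enumerate-surjective {p = inside  ∷ p} here        = zero , refl
enumerate-surjective {p = inside  ∷ p} (there x∈p) =
  let i , eq = enumerate-surjective x∈p in suc i , cong suc eq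
enumerate-surjective {p = outside ∷ p} (there x∈p) = map₂ (cong suc) (enumerate-surjective x∈p)

group : FinGroup → Group 0ℓ 0ℓ
group Γ = record
  { Carrier = Fin (order Γ) ; _≈_ = _≡_ ; _∙_ = _∙_ Γ ; ε = ε Γ ; _⁻¹ = _⁻¹ Γ ; isGroup = isGroup Γ }

module _ {n : ℕ} {Γ : Fin n → FinGroup} where
  private
    𝒢ₛ : Setoid 0ℓ 0ℓ
    𝒢ₛ = Π-setoid n (order ∘ Γ)
  open Setoid 𝒢ₛ using (_≈_)
  open SetoidMembership 𝒢ₛ using () renaming (_∈_ to _∈ₗ_)

  ∃𝒢? : {P : Pred (𝒢 Γ) 0ℓ} → Decidable P → P Respects _≈_ → Dec (Σ (𝒢 Γ) P)
  ∃𝒢? P? resp = map′ Any.satisfied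
    (λ (g , Pg) → Any.map (λ g≈h → resp g≈h Pg) (enum-complete n (order ∘ Γ) g))
    (any? P? (all𝒢 Γ))

  TrivialOn : Subset n → 𝒢 Γ → Set
  TrivialOn S h = ∀ y → y ∈ S → I {Γ = Γ} h y

  trivialOn-∪⁅⁆ : ∀ {S x h} → TrivialOn S h → I {Γ = Γ} h x → TrivialOn (S ∪ ⁅ x ⁆) h
  trivialOn-∪⁅⁆ {S} {x} trivial hx y y∈S∪x with x∈p∪q⁻ S ⁅ x ⁆ y∈S∪x
  ... | inj₁ y∈S = trivial y y∈S
  ... | inj₂ y∈x = subst (I {Γ = Γ} _) (sym (x∈⁅y⁆⇒x≡y x y∈x)) hx

  Determines : Subgroup Γ → Subset n → Subset n → Set
  Determines ℋ S T = ∀ k → mem ℋ k → TrivialOn S k → TrivialOn T k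

  record Separator (ℋ : Subgroup Γ) (S : Subset n) (x : Fin n) (h : 𝒢 Γ) : Set where
    field
      member       : mem ℋ h
      trivialOn    : TrivialOn S h
      nontrivialAt : ¬ I {Γ = Γ} h x

  restrict : Subset n → 𝒢 Γ → 𝒢 Γ
  restrict S g y with y ∈? S
  ... | yes _ = g y
  ... | no  _ = ε (Γ y)

  restrict-∈ : ∀ {S g y} → y ∈ S → restrict S g y ≡ g y
  restrict-∈ {S} {g} {y} y∈S with y ∈? S
  ... | yes _  = refl
  ... | no y∉S = ⊥-elim (y∉S y∈S)

  restrict-∉ : ∀ {S g y} → y ∉ S → restrict S g y ≡ ε (Γ y)
  restrict-∉ {S} {g} {y} y∉S with y ∈? S
  ... | yes y∈S = ⊥-elim (y∉S y∈S)
  ... | no _    = refl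

  module _ (ℋ : Subgroup Γ) where

    InProj-resp : ∀ S → InProj ℋ S Respects _≈_
    InProj-resp S g≈g' (g-off , g-lift) =
      (λ y y∉S → trans (sym (g≈g' y)) (g-off y y∉S)) ,
      Any.map (λ (h∈ℋ , h≈g) → h∈ℋ , λ y y∈S → trans (h≈g y y∈S) (g≈g' y)) g-lift

    InProj-restrict : ∀ {S T g} → S ⊆ T → InProj ℋ T g → InProj ℋ S (restrict S g)
    InProj-restrict S⊆T (_ , g-lift) =
      (λ _ → restrict-∉) ,
      Any.map (λ (h∈ℋ , h≈g) → h∈ℋ , λ y y∈S → trans (h≈g y (S⊆T y∈S)) (sym (restrict-∈ y∈S)))
        g-lift

    Determines⇒agree : ∀ {S T h h'} → Determines ℋ S T → mem ℋ h → mem ℋ h' →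
      (∀ y → y ∈ S → h y ≡ h' y) → ∀ y → y ∈ T → h y ≡ h' y
    Determines⇒agree {S} {h = h} {h'} determines h∈ℋ h'∈ℋ agree y y∈T =
      x∙y⁻¹≈ε⇒x≈y (group (Γ y)) (h y) (h' y) (determines hh'⁻¹ hh'⁻¹∈ℋ hh'⁻¹-trivialOn-S y y∈T)
      where
      hh'⁻¹ : 𝒢 Γ
      hh'⁻¹ = mul𝒢 Γ h (inv𝒢 Γ h')
      hh'⁻¹∈ℋ : mem ℋ hh'⁻¹
      hh'⁻¹∈ℋ = mul-mem ℋ h∈ℋ (inv-mem ℋ h'∈ℋ)
      hh'⁻¹-trivialOn-S : TrivialOn S hh'⁻¹
      hh'⁻¹-trivialOn-S z z∈S = x≈y⇒x∙y⁻¹≈ε (group (Γ z)) (agree z z∈S)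

    restrict-injectiveOn : ∀ {S T g g'} → S ⊆ T → Determines ℋ S T →
      InProj ℋ T g → InProj ℋ T g' → restrict S g ≈ restrict S g' → g ≈ g'
    restrict-injectiveOn {S} {T} {g} {g'} S⊆T determines (g-off , g-lift) (g'-off , g'-lift) eq y
      with y ∈? T
    ... | no y∉T = trans (g-off y y∉T) (sym (g'-off y y∉T))
    ... | yes y∈T
      with h , h∈ℋ , h≈g ← Any.satisfied g-lift
      with h' , h'∈ℋ , h'≈g' ← Any.satisfied g'-lift = begin
        g y  ≡⟨ h≈g y y∈T ⟨
        h y  ≡⟨ Determines⇒agree determines h∈ℋ h'∈ℋ h≈h'-on-S y y∈T ⟩
        h' y ≡⟨ h'≈g' y y∈T ⟩
        g' y ∎
      where
      open ≡-Reasoning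
      h≈h'-on-S : ∀ z → z ∈ S → h z ≡ h' z
      h≈h'-on-S z z∈S = begin
        h z              ≡⟨ h≈g z (S⊆T z∈S) ⟩
        g z              ≡⟨ restrict-∈ z∈S ⟨
        restrict S g z   ≡⟨ eq z ⟩
        restrict S g' z  ≡⟨ restrict-∈ z∈S ⟩
        g' z             ≡⟨ h'≈g' z (S⊆T z∈S) ⟨
        h' z             ∎

    Determines⇒card-≤ : ∀ {S T} → S ⊆ T → Determines ℋ S T → card ℋ T ≤ card ℋ S
    Determines⇒card-≤ {S} {T} S⊆T determines = begin
      card ℋ T                      ≡⟨ length-map (restrict S) ℋ_T ⟨
      length (map (restrict S) ℋ_T) ≤⟨ Unique-⊆⇒length-≤ 𝒢ₛ restricted-unique restricted-⊆ ⟩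
      card ℋ S                      ∎
      where
      open ≤-Reasoning
      ℋ_T : List (𝒢 Γ)
      ℋ_T = filter (InProj? ℋ T) (all𝒢 Γ)
      restricted-unique : Unique 𝒢ₛ (map (restrict S) ℋ_T)
      restricted-unique = Unique-map⁺-injectiveOn 𝒢ₛ 𝒢ₛ
        (restrict-injectiveOn S⊆T determines)
        (all-filter (InProj? ℋ T) (all𝒢 Γ))
        (Unique.filter⁺ 𝒢ₛ (InProj? ℋ T) (enum-unique n (order ∘ Γ)))
      restricted-⊆ : ∀ {v} → v ∈ₗ map (restrict S) ℋ_T → v ∈ₗ filter (InProj? ℋ S) (all𝒢 Γ)
      restricted-⊆ {v} v∈ with g , g∈ℋ_T , v≈g|S ← ∈-map⁻ 𝒢ₛ 𝒢ₛ v∈ =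
        ∈-filter⁺ 𝒢ₛ (InProj? ℋ S) (InProj-resp S) (enum-complete n (order ∘ Γ) v)
          (InProj-resp S (λ y → sym (v≈g|S y)) (InProj-restrict S⊆T InProj-g))
        where
        InProj-g : InProj ℋ T g
        InProj-g = proj₂ (∈-filter⁻ 𝒢ₛ (InProj? ℋ T) (InProj-resp T) {xs = all𝒢 Γ} g∈ℋ_T)

    separator? : ∀ S x h → Dec (Separator ℋ S x h)
    separator? S x h =
      map′ (λ (h∈ℋ , trivial , nontrivial) → record
             { member = h∈ℋ ; trivialOn = trivial ; nontrivialAt = nontrivial })
           (λ sep → Separator.member sep , Separator.trivialOn sep , Separator.nontrivialAt sep)
           (mem? ℋ h ×-dec all? (λ y → y ∈? S →-dec (h y ≟ ε (Γ y))) ×-dec ¬? (h x ≟ ε (Γ x)))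

    Separator-resp : ∀ S x → Separator ℋ S x Respects _≈_
    Separator-resp S x h≈h' sep = record
      { member       = resp ℋ h≈h' member
      ; trivialOn    = λ y y∈S → trans (sym (h≈h' y)) (trivialOn y y∈S)
      ; nontrivialAt = λ h'x≡ε → nontrivialAt (trans (h≈h' x) h'x≡ε)
      }
      where open Separator sep

    flat⇒separator : ∀ {S x} → IsFlat ℋ S → x ∉ S → Σ (𝒢 Γ) (Separator ℋ S x)
    flat⇒separator {S} {x} flat x∉S =
      decidable-stable (∃𝒢? (separator? S x) (Separator-resp S x)) λ no-separator →
        <⇒≱ (flat x x∉S) (Determines⇒card-≤ (p⊆p∪q ⁅ x ⁆) (determines no-separator))
      where
      determines : ¬ Σ (𝒢 Γ) (Separator ℋ S x) → Determines ℋ S (S ∪ ⁅ x ⁆)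
      determines no-separator k k∈ℋ trivial = trivialOn-∪⁅⁆ trivial
        (decidable-stable (k x ≟ ε (Γ x)) λ kx≢ε →
          no-separator (k , record { member = k∈ℋ ; trivialOn = trivial ; nontrivialAt = kx≢ε }))

proposition7p5 : (n : ℕ) (Γ : Fin n → FinGroup) (ℋ : Subgroup Γ) (S : Subset n) →
    IsFlat ℋ S →
    Σ ℕ (λ l → (l ≤ ∣ ∁ S ∣) × Σ (Fin l → 𝒢 Γ) (λ hs →
      ((i : Fin l) → mem ℋ (hs i)) ×
      ((x : Fin n) → (x ∈ S) ⇔ ((i : Fin l) → I {Γ = Γ} (hs i) x))))
proposition7p5 n Γ ℋ S flat =
  ∣ ∁ S ∣ , ≤-refl , hs , (λ i → Separator.member (proj₂ (separator i))) ,
  λ x → mk⇔ (λ x∈S i → Separator.trivialOn (proj₂ (separator i)) x x∈S) (trivial⇒∈ x)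
  where
  separator : (i : Fin ∣ ∁ S ∣) → Σ (𝒢 Γ) (Separator ℋ S (enumerate (∁ S) i))
  separator i = flat⇒separator ℋ flat (x∈∁p⇒x∉p (enumerate-∈ (∁ S) i))
  hs : Fin ∣ ∁ S ∣ → 𝒢 Γ
  hs = proj₁ ∘ separator
  trivial⇒∈ : ∀ x → (∀ i → I {Γ = Γ} (hs i) x) → x ∈ S
  trivial⇒∈ x trivial = decidable-stable (x ∈? S) λ x∉S →
    let i , eᵢ≡x = enumerate-surjective (x∉p⇒x∈∁p x∉S)
    in Separator.nontrivialAt (proj₂ (separator i))
         (subst (I {Γ = Γ} (hs i)) (sym eᵢ≡x) (trivial i))
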